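{- Let $F$ be an $(n,m)$-function and let $\omega=\sum_{W\in\mathcal{W}_F}W^4$. Then the number of nonvanishing $2$-flats of $F$ is \[|N_{\mathcal{A},2}(F)|=\frac{2^{4n}(2^m-1)-\omega}{3\cdot 2^{n+m+3}}.\] In particular, if $m=1$ (so $F=f$ is a Boolean function), then $|N_{\mathcal{A},2}(f)|=\frac{2^{4n}-\omega}{3\cdot 2^{n+4}}$.
   Context: An $(n,m)$-function is a map $F\colon\mathbb{F}_2^n\to\mathbb{F}_2^m$. A $2$-flat is a set $U+a$ with $U$ a $2$-dimensional linear subspace of $\mathbb{F}_2^n$ and $a\in\mathbb{F}_2^n$; it is nonvanishing for $F$ if $\sum_{x\in U+a}F(x)\neq 0$. $N_{\mathcal{A},2}(F)$ is the set of nonvanishing $2$-flats of $F$. The Walsh transform of a Boolean function $g\colon\mathbb{F}_2^n\to\mathbb{F}_2$ is $W_g(a)=\sum_{x\in\mathbb{F}_2^n}(-1)^{g(x)+\langle x,a\rangle}$ ($\langle\cdot,\cdot\rangle$ the standard dot product), and its Walsh spectrum is the multiset $\{W_g(a):a\in\mathbb{F}_2^n\}$. The Walsh spectrum $\mathcal{W}_F$ of $F$ is the multiset union, over all nonzero $b\in\mathbb{F}_2^m$, of the Walsh spectra of the component functions $f_b(x)=\langle b,F(x)\rangle$; the sum defining $\omega$ is taken with multiplicity. -}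

module Defs where

open import Data.Bool using (Bool; true; false; _xor_; _∧_; if_then_else_)
open import Data.Nat as ℕ using (ℕ; zero; suc)
open import Data.Integer as ℤ using (ℤ; +_; -_)
open import Data.Vec using (Vec; []; _∷_; zipWith; replicate)
open import Data.List using (List; []; _∷_; map; _++_; foldr; filter; length)
open import Data.Product using (_×_; _,_; ∃-syntax)
open import Relation.Binary.PropositionalEquality using (_≡_)
open import Relation.Nullary using (¬_)
open import Function.Bundles using (_⇔_)

-- Vectors of F_2^n are Vec Bool n (true = 1, xor = addition).
𝔽₂^ : ℕ → Set
𝔽₂^ n = Vec Bool n

_⊕_ : ∀ {n} → 𝔽₂^ n → 𝔽₂^ n → 𝔽₂^ n
_⊕_ = zipWith _xor_

𝟎 : ∀ {n} → 𝔽₂^ n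
𝟎 {n} = replicate n false

_·_ : ∀ {n} → Bool → 𝔽₂^ n → 𝔽₂^ n
b · x = zipWith (λ _ y → b ∧ y) x x

⟨_,_⟩ : ∀ {n} → 𝔽₂^ n → 𝔽₂^ n → Bool
⟨ x , y ⟩ = foldrV (zipWith _∧_ x y)
  where
  foldrV : ∀ {k} → Vec Bool k → Bool
  foldrV [] = false
  foldrV (b ∷ bs) = b xor foldrV bs

allVecs : (n : ℕ) → List (𝔽₂^ n)
allVecs zero = [] ∷ []
allVecs (suc n) = map (false ∷_) (allVecs n) ++ map (true ∷_) (allVecs n)

-- Subsets of F_2^n, represented by their (finite) truth table, so that
-- propositional equality of subsets is extensional equality.
Subset : ℕ → Set
Subset zero = Bool
Subset (suc n) = Subset n × Subset n

_∈ₛ_ : ∀ {n} → 𝔽₂^ n → Subset n → Set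
_∈ₛ_ {zero} [] b = b ≡ true
_∈ₛ_ {suc n} (false ∷ x) (s₀ , s₁) = x ∈ₛ s₀
_∈ₛ_ {suc n} (true ∷ x) (s₀ , s₁) = x ∈ₛ s₁

LinIndep₂ : ∀ {n} → 𝔽₂^ n → 𝔽₂^ n → Set
LinIndep₂ u v = ∀ (λ₁ λ₂ : Bool) → (λ₁ · u) ⊕ (λ₂ · v) ≡ 𝟎 → (λ₁ ≡ false) × (λ₂ ≡ false)

Is2Flat : ∀ {n} → Subset n → Set
Is2Flat {n} S = ∃[ a ] ∃[ u ] ∃[ v ] (LinIndep₂ {n} u v ×
  (∀ x → (x ∈ₛ S) ⇔ (∃[ λ₁ ] ∃[ λ₂ ] (x ≡ a ⊕ ((λ₁ · u) ⊕ (λ₂ · v))))))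

member : ∀ {n} → 𝔽₂^ n → Subset n → Bool
member {zero} [] b = b
member {suc n} (false ∷ x) (s₀ , s₁) = member x s₀
member {suc n} (true ∷ x) (s₀ , s₁) = member x s₁

sumOver : ∀ {n m} → Subset n → (𝔽₂^ n → 𝔽₂^ m) → 𝔽₂^ m
sumOver {n} S F = foldr (λ x acc → (if member x S then F x else 𝟎) ⊕ acc) 𝟎 (allVecs n)

IsNonvanishing2Flat : ∀ {n m} → (𝔽₂^ n → 𝔽₂^ m) → Subset n → Set
IsNonvanishing2Flat F S = Is2Flat S × ¬ (sumOver S F ≡ 𝟎)

sumℤ : ∀ {A : Set} → (A → ℤ) → List A → ℤ
sumℤ f = foldr (λ x acc → f x ℤ.+ acc) (+ 0)

sign : Bool → ℤ
sign false = + 1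
sign true = - (+ 1)

walsh : ∀ {n} → (𝔽₂^ n → Bool) → 𝔽₂^ n → ℤ
walsh {n} g a = sumℤ (λ x → sign (g x xor ⟨ x , a ⟩)) (allVecs n)

component : ∀ {n m} → (𝔽₂^ n → 𝔽₂^ m) → 𝔽₂^ m → 𝔽₂^ n → Bool
component F b x = ⟨ b , F x ⟩

isZero : ∀ {m} → 𝔽₂^ m → Bool
isZero [] = true
isZero (true ∷ _) = false
isZero (false ∷ x) = isZero x

nonzeroVecs : (m : ℕ) → List (𝔽₂^ m)
nonzeroVecs m = filter (λ b → Data.Bool._≟_ (isZero b) false) (allVecs m)
  where import Data.Bool

_^4 : ℤ → ℤ
w ^4 = w ℤ.* w ℤ.* w ℤ.* w

-- ω = ∑_{W ∈ 𝒲_F} W^4, with multiplicity: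
-- sum over nonzero b and all a of W_{f_b}(a)^4
ω : ∀ {n m} → (𝔽₂^ n → 𝔽₂^ m) → ℤ
ω {n} {m} F = sumℤ (λ b → sumℤ (λ a → walsh (component F b) a ^4) (allVecs n)) (nonzeroVecs m)

{-# OPTIONS --safe #-}

-- Expanding W(a)⁴ and summing over a with the orthogonality of characters gives
--   Σₐ W_{f_b}(a)⁴ = 2ⁿ Σ_{x,y,z} (−1)^(f_b(x) + f_b(y) + f_b(z) + f_b(x+y+z)),
-- and summing over b ≠ 0 turns the sign into 2ᵐ[D = 0] − 1, where D(x,y,z) = F(x) + F(y) + F(z) + F(x+y+z).
-- Hence ω = 2⁴ⁿ(2ᵐ − 1) − 2ⁿ⁺ᵐ · #{(x,y,z) : D(x,y,z) ≠ 0}.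
-- A triple with D ≠ 0 consists of three distinct points, and D is the sum of F over the 2-flat
-- {x, y, z, x+y+z} they span. Conversely a 2-flat is the flat through any three of its distinct
-- points (in coordinates, a finite fact about the plane 𝔽₂²), so every nonvanishing 2-flat arises
-- from exactly 4·3·2 = 24 ordered triples and the number of nonvanishing triples is 24 |N|.

module Submission where

open import Algebra.Bundles using (AbelianGroup; CommutativeMonoid; CommutativeRing)
open import Algebra.Core using (Op₂)
import Algebra.Properties.AbelianGroup as AbelianGroupProperties
import Algebra.Properties.CommutativeSemigroup as CommutativeSemigroupProperties
open import Algebra.Structures using (IsAbelianGroup; IsCommutativeMonoid)
open import Data.Bool using (Bool; true; false; not; _∧_; _xor_; if_then_else_)
import Data.Bool.Properties as Bool
open import Data.Empty using (⊥)
open import Data.Integer using (ℤ; +_; -_; _+_; _-_; _*_)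
import Data.Integer.Properties as ℤ
open import Data.Integer.Tactic.RingSolver using (solve-∀)
open import Data.List using (List; []; _∷_; _++_; map; foldr; filter; length; cartesianProduct; deduplicate)
import Data.List.Membership.DecPropositional as DecMembership
open import Data.List.Membership.Propositional using (_∈_; _∉_)
import Data.List.Membership.Propositional.Properties as ∈
import Data.List.Properties as List
open import Data.List.Relation.Unary.All as All using (All; all?; []; _∷_)
open import Data.List.Relation.Unary.AllPairs using ([]; _∷_)
open import Data.List.Relation.Unary.Any using (here; there)
open import Data.List.Relation.Unary.Unique.Propositional using (Unique)
import Data.List.Relation.Unary.Unique.Propositional.Properties as Unique
open import Data.List.Relation.Unary.Unique.DecPropositional.Properties using (deduplicate-!)
open import Data.Nat using (ℕ; zero; suc; _^_; _∸_)
import Data.Nat as ℕ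
import Data.Nat.Properties as ℕ
import Data.Nat.Tactic.RingSolver as ℕ-Solver
open import Data.Product using (_×_; _,_; proj₁; proj₂; ∃-syntax; Σ-syntax)
import Data.Product.Properties as Product
open import Data.Vec using ([]; _∷_; tail)
import Data.Vec.Properties as Vec
open import Function using (id; _∘_; case_of_)
open import Function.Bundles using (_⇔_; mk⇔; Equivalence)
open import Function.Properties.Equivalence using (⇔-setoid) renaming (trans to ⇔-trans; sym to ⇔-sym)
open import Level using (0ℓ)
open import Relation.Binary.Definitions using (DecidableEquality)
open import Relation.Binary.PropositionalEquality using (_≡_; _≢_; refl; sym; trans; cong; cong₂; subst; subst₂; isEquivalence; module ≡-Reasoning)
open import Relation.Nullary using (¬_; Dec; does; yes; no; ¬?; _×-dec_; _→-dec_; contradiction)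
open import Relation.Nullary.Decidable using (toWitness; dec-true; dec-false; decidable-stable)
open import Relation.Unary using (Decidable)

open import Defs

private variable
  X Y : Set
  n m : ℕ

-- Sums over lists

module ListSum {A : Set} {_∙_ : Op₂ A} {ε : A} (isCM : IsCommutativeMonoid _≡_ _∙_ ε) where

  open IsCommutativeMonoid isCM using (assoc; identityˡ; identityʳ)

  private
    commutativeMonoid : CommutativeMonoid 0ℓ 0ℓ
    commutativeMonoid = record { isCommutativeMonoid = isCM }

  open CommutativeSemigroupProperties (CommutativeMonoid.commutativeSemigroup commutativeMonoid)
    using (interchange)

  ∑ : {X : Set} → (X → A) → List X → A
  ∑ f = foldr (λ x acc → f x ∙ acc) ε

  ∑-cong∈ : ∀ {f g : X → A} xs → (∀ x → x ∈ xs → f x ≡ g x) → ∑ f xs ≡ ∑ g xs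
  ∑-cong∈ []       eq = refl
  ∑-cong∈ (x ∷ xs) eq = cong₂ _∙_ (eq x (here refl)) (∑-cong∈ xs (λ y → eq y ∘ there))

  ∑-cong : ∀ {f g : X → A} xs → (∀ x → f x ≡ g x) → ∑ f xs ≡ ∑ g xs
  ∑-cong xs eq = ∑-cong∈ xs (λ x _ → eq x)

  ∑-++ : ∀ (f : X → A) xs ys → ∑ f (xs ++ ys) ≡ ∑ f xs ∙ ∑ f ys
  ∑-++ f []       ys = sym (identityˡ _)
  ∑-++ f (x ∷ xs) ys = trans (cong (f x ∙_) (∑-++ f xs ys)) (sym (assoc _ _ _))

  ∑-map : ∀ (f : Y → A) (g : X → Y) xs → ∑ f (map g xs) ≡ ∑ (f ∘ g) xs
  ∑-map f g []       = refl
  ∑-map f g (x ∷ xs) = cong (f (g x) ∙_) (∑-map f g xs)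

  ∑-ε : ∀ (xs : List X) → ∑ (λ _ → ε) xs ≡ ε
  ∑-ε []       = refl
  ∑-ε (x ∷ xs) = trans (cong (ε ∙_) (∑-ε xs)) (identityˡ ε)

  ∑-∙ : ∀ (f g : X → A) xs → ∑ (λ x → f x ∙ g x) xs ≡ ∑ f xs ∙ ∑ g xs
  ∑-∙ f g []       = sym (identityˡ ε)
  ∑-∙ f g (x ∷ xs) = trans (cong ((f x ∙ g x) ∙_) (∑-∙ f g xs)) (interchange _ _ _ _)

  ∑-swap : ∀ (f : X → Y → A) xs ys →
           ∑ (λ x → ∑ (f x) ys) xs ≡ ∑ (λ y → ∑ (λ x → f x y) xs) ys
  ∑-swap f []       ys = sym (∑-ε ys)
  ∑-swap f (x ∷ xs) ys = trans (cong (∑ (f x) ys ∙_) (∑-swap f xs ys))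
                               (sym (∑-∙ (f x) (λ y → ∑ (λ x → f x y) xs) ys))

  ∑-filter : ∀ {P : X → Set} (P? : Decidable P) (f : X → A) xs →
             ∑ f (filter P? xs) ≡ ∑ (λ x → if does (P? x) then f x else ε) xs
  ∑-filter P? f []       = refl
  ∑-filter P? f (x ∷ xs) with does (P? x)
  ... | true  = cong (f x ∙_) (∑-filter P? f xs)
  ... | false = trans (∑-filter P? f xs) (sym (identityˡ _))

  ∑³ : (X → X → X → A) → List X → A
  ∑³ f xs = ∑ (λ x → ∑ (λ y → ∑ (λ z → f x y z) xs) xs) xs

  ∑³-cong : ∀ {f g : X → X → X → A} xs → (∀ x y z → f x y z ≡ g x y z) → ∑³ f xs ≡ ∑³ g xs
  ∑³-cong xs eq = ∑-cong xs λ x → ∑-cong xs λ y → ∑-cong xs λ z → eq x y z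

  ∑-∑³-swap : ∀ (f : Y → X → X → X → A) ys xs →
              ∑ (λ b → ∑³ (f b) xs) ys ≡ ∑³ (λ x y z → ∑ (λ b → f b x y z) ys) xs
  ∑-∑³-swap f ys xs =
    trans (∑-swap _ ys xs) (∑-cong xs λ x →
    trans (∑-swap _ ys xs) (∑-cong xs λ y →
          ∑-swap _ ys xs))

  module _ {X : Set} (_≟_ : DecidableEquality X) where

    open import Data.List.Membership.DecPropositional _≟_ using (_∈?_)

    ∑-δ-∉ : ∀ (f : X → A) {y} xs → y ∉ xs → ∑ (λ x → if does (x ≟ y) then f x else ε) xs ≡ ε
    ∑-δ-∉ f []       y∉xs = refl
    ∑-δ-∉ f {y} (x ∷ xs) y∉xs with x ≟ y
    ... | yes refl = contradiction (here refl) y∉xs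
    ... | no  _    = trans (identityˡ _) (∑-δ-∉ f xs (y∉xs ∘ there))

    ∑-δ : ∀ (f : X → A) {y xs} → Unique xs → y ∈ xs →
          ∑ (λ x → if does (x ≟ y) then f x else ε) xs ≡ f y
    ∑-δ f {y} {x ∷ xs} (x∉xs ∷ _) (here refl) with x ≟ x
    ... | yes _  = trans (cong (f x ∙_) (∑-δ-∉ f xs λ x∈xs → All.lookup x∉xs x∈xs refl)) (identityʳ _)
    ... | no x≢x = contradiction refl x≢x
    ∑-δ f {y} {x ∷ xs} (x∉xs ∷ u) (there y∈xs) with x ≟ y
    ... | yes refl = contradiction refl (All.lookup x∉xs y∈xs)
    ... | no  _    = trans (identityˡ _) (∑-δ f u y∈xs)

    ∑-select : ∀ (f : X → A) {xs} ys → Unique xs → Unique ys → (∀ {y} → y ∈ ys → y ∈ xs) →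
               ∑ (λ x → if does (x ∈? ys) then f x else ε) xs ≡ ∑ f ys
    ∑-select f {xs} []   uxs uys ys⊆xs = ∑-ε xs
    ∑-select f {xs} (y ∷ ys) uxs (y∉ys ∷ uys) ys⊆xs = begin
      ∑ (λ x → if does (x ∈? (y ∷ ys)) then f x else ε) xs
        ≡⟨ ∑-cong xs split ⟩
      ∑ (λ x → (if does (x ≟ y) then f x else ε) ∙ (if does (x ∈? ys) then f x else ε)) xs
        ≡⟨ ∑-∙ _ _ xs ⟩
      ∑ (λ x → if does (x ≟ y) then f x else ε) xs ∙ ∑ (λ x → if does (x ∈? ys) then f x else ε) xs
        ≡⟨ cong₂ _∙_ (∑-δ f uxs (ys⊆xs (here refl))) (∑-select f ys uxs uys (ys⊆xs ∘ there)) ⟩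
      f y ∙ ∑ f ys ∎
      where
      open ≡-Reasoning
      split : ∀ x → (if does (x ∈? (y ∷ ys)) then f x else ε)
                  ≡ (if does (x ≟ y) then f x else ε) ∙ (if does (x ∈? ys) then f x else ε)
      split x with x ≟ y
      ... | no _ = sym (identityˡ _)
      ... | yes refl with x ∈? ys
      ...   | yes x∈ys = contradiction refl (All.lookup y∉ys x∈ys)
      ...   | no  _    = sym (identityʳ _)

open ListSum ℤ.+-0-isCommutativeMonoid

∑-*ˡ : ∀ c (f : X → ℤ) xs → ∑ (λ x → c * f x) xs ≡ c * ∑ f xs
∑-*ˡ c f []       = sym (ℤ.*-zeroʳ c)
∑-*ˡ c f (x ∷ xs) = trans (cong (_+_ (c * f x)) (∑-*ˡ c f xs)) (sym (ℤ.*-distribˡ-+ c (f x) _))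

∑-*ʳ : ∀ c (f : X → ℤ) xs → ∑ (λ x → f x * c) xs ≡ ∑ f xs * c
∑-*ʳ c f xs = trans (∑-cong xs λ x → ℤ.*-comm (f x) c) (trans (∑-*ˡ c f xs) (ℤ.*-comm c _))

∑-neg : ∀ (f : X → ℤ) xs → ∑ (λ x → - f x) xs ≡ - ∑ f xs
∑-neg f []       = refl
∑-neg f (x ∷ xs) = trans (cong (_+_ (- f x)) (∑-neg f xs)) (sym (ℤ.neg-distrib-+ (f x) _))

∑-- : ∀ (f g : X → ℤ) xs → ∑ (λ x → f x - g x) xs ≡ ∑ f xs - ∑ g xs
∑-- f g xs = trans (∑-∙ f (λ x → - g x) xs) (cong (_+_ (∑ f xs)) (∑-neg g xs))

∑-const : ∀ c (xs : List X) → ∑ (λ _ → c) xs ≡ + length xs * c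
∑-const c []       = refl
∑-const c (x ∷ xs) = begin
  c + ∑ (λ _ → c) xs             ≡⟨ cong₂ _+_ (sym (ℤ.*-identityˡ c)) (∑-const c xs) ⟩
  + 1 * c + + length xs * c      ≡⟨ ℤ.*-distribʳ-+ c (+ 1) (+ length xs) ⟨
  + length (x ∷ xs) * c          ∎
  where open ≡-Reasoning

∑-affine : ∀ α β (g : X → ℤ) xs → ∑ (λ x → α - β * g x) xs ≡ + length xs * α - β * ∑ g xs
∑-affine α β g xs = trans (∑-- (λ _ → α) (λ x → β * g x) xs) (cong₂ _-_ (∑-const α xs) (∑-*ˡ β g xs))

∑³-affine : ∀ α β (g : X → X → X → ℤ) xs →
  ∑³ (λ x y z → α - β * g x y z) xs ≡ + length xs * (+ length xs * (+ length xs * α)) - β * ∑³ g xs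
∑³-affine α β g xs =
  trans (∑-cong xs λ x → trans (∑-cong xs λ y → ∑-affine α β (g x y) xs)
                               (∑-affine (+ length xs * α) β (λ y → ∑ (g x y) xs) xs))
        (∑-affine (+ length xs * (+ length xs * α)) β (λ x → ∑ (λ y → ∑ (g x y) xs) xs) xs)

∑-mul : ∀ (f : X → ℤ) (g : Y → ℤ) xs ys → ∑ f xs * ∑ g ys ≡ ∑ (λ x → ∑ (λ y → f x * g y) ys) xs
∑-mul f g xs ys = trans (sym (∑-*ʳ (∑ g ys) f xs)) (∑-cong xs λ x → sym (∑-*ˡ (f x) g ys))

∑-^4 : ∀ (f : X → ℤ) xs → (∑ f xs) ^4 ≡ ∑³ (λ x y z → ∑ (λ w → f x * (f y * (f z * f w))) xs) xs
∑-^4 f xs = begin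
  S ^4                                                        ≡⟨ reassoc S ⟩
  S * (S * (S * S))                                           ≡⟨ cong (λ t → S * (S * t)) (∑-mul f f xs xs) ⟩
  S * (S * ∑ (λ z → ∑ (λ w → f z * f w) xs) xs)               ≡⟨ cong (S *_) (∑-mul f _ xs xs) ⟩
  S * ∑ (λ y → ∑ (λ z → f y * ∑ (λ w → f z * f w) xs) xs) xs
    ≡⟨ cong (S *_) (∑-cong xs λ y → ∑-cong xs λ z → sym (∑-*ˡ (f y) _ xs)) ⟩
  S * ∑ (λ y → ∑ (λ z → ∑ (λ w → f y * (f z * f w)) xs) xs) xs ≡⟨ ∑-mul f _ xs xs ⟩
  ∑ (λ x → ∑ (λ y → f x * ∑ (λ z → ∑ (λ w → f y * (f z * f w)) xs) xs) xs) xs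
    ≡⟨ ∑-cong xs (λ x → ∑-cong xs λ y → trans (sym (∑-*ˡ (f x) _ xs)) (∑-cong xs λ z → sym (∑-*ˡ (f x) _ xs))) ⟩
  ∑³ (λ x y z → ∑ (λ w → f x * (f y * (f z * f w))) xs) xs ∎
  where
  open ≡-Reasoning
  S : ℤ
  S = ∑ f xs
  reassoc : ∀ s → s * s * s * s ≡ s * (s * (s * s))
  reassoc = solve-∀

𝟙 : Bool → ℤ
𝟙 b = if b then + 1 else + 0

*-𝟙 : ∀ x b → x * 𝟙 b ≡ (if b then x else + 0)
*-𝟙 x true  = ℤ.*-identityʳ x
*-𝟙 x false = ℤ.*-zeroʳ x

𝟙-* : ∀ b x → 𝟙 b * x ≡ (if b then x else + 0)
𝟙-* true  x = ℤ.*-identityˡ x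
𝟙-* false x = refl

𝟙-∧-* : ∀ a b x → 𝟙 (a ∧ b) * x ≡ 𝟙 a * (𝟙 b * x)
𝟙-∧-* true  b x = sym (ℤ.*-identityˡ _)
𝟙-∧-* false b x = refl

-- The vector space 𝔽₂ⁿ

_≟_ : DecidableEquality (𝔽₂^ n)
_≟_ = Vec.≡-dec Bool._≟_

_∈?_ : (x : 𝔽₂^ n) (xs : List (𝔽₂^ n)) → Dec (x ∈ xs)
x ∈? xs = DecMembership._∈?_ _≟_ x xs

⊕-self : (x : 𝔽₂^ n) → x ⊕ x ≡ 𝟎
⊕-self []       = refl
⊕-self (b ∷ x) = cong₂ _∷_ (Bool.xor-same b) (⊕-self x)

⊕-isAbelianGroup : IsAbelianGroup _≡_ (_⊕_ {n}) 𝟎 id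
⊕-isAbelianGroup = record
  { isGroup = record
    { isMonoid = record
      { isSemigroup = record
        { isMagma = record { isEquivalence = isEquivalence ; ∙-cong = cong₂ _⊕_ }
        ; assoc = Vec.zipWith-assoc Bool.xor-assoc
        }
      ; identity = Vec.zipWith-identityˡ Bool.xor-identityˡ , Vec.zipWith-identityʳ Bool.xor-identityʳ
      }
    ; inverse = ⊕-self , ⊕-self
    ; ⁻¹-cong = id
    }
  ; comm = Vec.zipWith-comm Bool.xor-comm
  }

⊕-abelianGroup : ℕ → AbelianGroup 0ℓ 0ℓ
⊕-abelianGroup n = record { isAbelianGroup = ⊕-isAbelianGroup {n} }

module 𝔽 {n : ℕ} where
  open IsAbelianGroup (⊕-isAbelianGroup {n}) public
    using (assoc; identityˡ; identityʳ; isCommutativeMonoid)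
  open AbelianGroupProperties (⊕-abelianGroup n) public
  open CommutativeSemigroupProperties (AbelianGroup.commutativeSemigroup (⊕-abelianGroup n)) public

module Xor = CommutativeSemigroupProperties (CommutativeRing.+-commutativeSemigroup Bool.xor-∧-commutativeRing)

⊕≡𝟎⇒≡ : {x y : 𝔽₂^ n} → x ⊕ y ≡ 𝟎 → x ≡ y
⊕≡𝟎⇒≡ = 𝔽.inverseˡ-unique _ _

x⊕[x⊕y]≡y : (x y : 𝔽₂^ n) → x ⊕ (x ⊕ y) ≡ y
x⊕[x⊕y]≡y = 𝔽.\\-leftDividesʳ

module ∑ᵥ {m : ℕ} = ListSum (𝔽.isCommutativeMonoid {m})

·-zeroˡ : (x : 𝔽₂^ n) → false · x ≡ 𝟎
·-zeroˡ []      = refl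
·-zeroˡ (_ ∷ x) = cong (false ∷_) (·-zeroˡ x)

·-identityˡ : (x : 𝔽₂^ n) → true · x ≡ x
·-identityˡ []      = refl
·-identityˡ (b ∷ x) = cong (b ∷_) (·-identityˡ x)

·-distribʳ-xor : (x : 𝔽₂^ n) (l k : Bool) → (l · x) ⊕ (k · x) ≡ (l xor k) · x
·-distribʳ-xor []      l k = refl
·-distribʳ-xor (b ∷ x) l k = cong₂ _∷_ (sym (Bool.∧-distribʳ-xor b l k)) (·-distribʳ-xor x l k)

⟨⟩-comm : (x y : 𝔽₂^ n) → ⟨ x , y ⟩ ≡ ⟨ y , x ⟩
⟨⟩-comm []      []      = refl
⟨⟩-comm (b ∷ x) (c ∷ y) = cong₂ _xor_ (Bool.∧-comm b c) (⟨⟩-comm x y)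

⟨⟩-⊕ˡ : (x y a : 𝔽₂^ n) → ⟨ x ⊕ y , a ⟩ ≡ ⟨ x , a ⟩ xor ⟨ y , a ⟩
⟨⟩-⊕ˡ []      []      []      = refl
⟨⟩-⊕ˡ (b ∷ x) (c ∷ y) (d ∷ a) = begin
  ((b xor c) ∧ d) xor ⟨ x ⊕ y , a ⟩                      ≡⟨ cong₂ _xor_ (Bool.∧-distribʳ-xor d b c) (⟨⟩-⊕ˡ x y a) ⟩
  ((b ∧ d) xor (c ∧ d)) xor (⟨ x , a ⟩ xor ⟨ y , a ⟩)   ≡⟨ Xor.interchange (b ∧ d) (c ∧ d) ⟨ x , a ⟩ ⟨ y , a ⟩ ⟩
  ((b ∧ d) xor ⟨ x , a ⟩) xor ((c ∧ d) xor ⟨ y , a ⟩)   ∎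
  where open ≡-Reasoning

⟨⟩-⊕ʳ : (a x y : 𝔽₂^ n) → ⟨ a , x ⊕ y ⟩ ≡ ⟨ a , x ⟩ xor ⟨ a , y ⟩
⟨⟩-⊕ʳ a x y = trans (⟨⟩-comm a _) (trans (⟨⟩-⊕ˡ x y a) (cong₂ _xor_ (⟨⟩-comm x a) (⟨⟩-comm y a)))

⟨⟩-zeroˡ : (a : 𝔽₂^ n) → ⟨ 𝟎 , a ⟩ ≡ false
⟨⟩-zeroˡ []      = refl
⟨⟩-zeroˡ (_ ∷ a) = ⟨⟩-zeroˡ a

∈-allVecs : (x : 𝔽₂^ n) → x ∈ allVecs n
∈-allVecs []          = here refl
∈-allVecs {suc n} (false ∷ x) = ∈.∈-++⁺ˡ (∈.∈-map⁺ (false ∷_) (∈-allVecs x))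
∈-allVecs {suc n} (true ∷ x)  = ∈.∈-++⁺ʳ (map (false ∷_) (allVecs n)) (∈.∈-map⁺ (true ∷_) (∈-allVecs x))

allVecs-unique : ∀ n → Unique (allVecs n)
allVecs-unique zero    = [] ∷ []
allVecs-unique (suc n) = Unique.++⁺ (Unique.map⁺ (cong tail) (allVecs-unique n))
                                    (Unique.map⁺ (cong tail) (allVecs-unique n))
                                    heads-differ
  where
  heads-differ : ∀ {v} → v ∈ map (false ∷_) (allVecs n) × v ∈ map (true ∷_) (allVecs n) → ⊥
  heads-differ (p , q) with ∈.∈-map⁻ (false ∷_) p | ∈.∈-map⁻ (true ∷_) q
  ... | _ , _ , refl | _ , _ , ()

length-allVecs : ∀ n → length (allVecs n) ≡ 2 ^ n
length-allVecs zero    = refl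
length-allVecs (suc n) = begin
  length (map (false ∷_) (allVecs n) ++ map (true ∷_) (allVecs n))  ≡⟨ List.length-++ (map (false ∷_) (allVecs n)) ⟩
  length (map (false ∷_) (allVecs n)) ℕ.+ length (map (true ∷_) (allVecs n))
    ≡⟨ cong₂ ℕ._+_ (trans (List.length-map _ (allVecs n)) (length-allVecs n))
                   (trans (List.length-map _ (allVecs n)) (trans (length-allVecs n) (sym (ℕ.+-identityʳ _)))) ⟩
  2 ^ suc n ∎
  where open ≡-Reasoning

isZero≡does-≟𝟎 : (x : 𝔽₂^ n) → isZero x ≡ does (x ≟ 𝟎)
isZero≡does-≟𝟎 []          = refl
isZero≡does-≟𝟎 (true ∷ x)  = refl
isZero≡does-≟𝟎 (false ∷ x) = isZero≡does-≟𝟎 x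

-- Characters and the fourth moment of the Walsh spectrum

sign-xor : ∀ a b → sign (a xor b) ≡ sign a * sign b
sign-xor false false = refl
sign-xor false true  = refl
sign-xor true  false = refl
sign-xor true  true  = refl

sign-not : ∀ a → sign (not a) ≡ - sign a
sign-not false = refl
sign-not true  = refl

∑-character : (s : 𝔽₂^ n) → ∑ (λ a → sign ⟨ s , a ⟩) (allVecs n) ≡ + (2 ^ n) * 𝟙 (does (s ≟ 𝟎))
∑-character []      = refl
∑-character {suc n} (b ∷ s) = begin
  ∑ χ (map (false ∷_) (allVecs n) ++ map (true ∷_) (allVecs n))
    ≡⟨ ∑-++ χ (map (false ∷_) (allVecs n)) _ ⟩
  ∑ χ (map (false ∷_) (allVecs n)) + ∑ χ (map (true ∷_) (allVecs n))
    ≡⟨ cong₂ _+_ (∑-map χ (false ∷_) (allVecs n)) (∑-map χ (true ∷_) (allVecs n)) ⟩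
  ∑ (λ a → sign ((b ∧ false) xor ⟨ s , a ⟩)) (allVecs n) + ∑ (λ a → sign ((b ∧ true) xor ⟨ s , a ⟩)) (allVecs n)
    ≡⟨ halves b ⟩
  + (2 ^ suc n) * 𝟙 (does ((b ∷ s) ≟ 𝟎)) ∎
  where
  open ≡-Reasoning
  χ : 𝔽₂^ (suc n) → ℤ
  χ a = sign ⟨ b ∷ s , a ⟩
  S : ℤ
  S = ∑ (λ a → sign ⟨ s , a ⟩) (allVecs n)
  double : ∀ k d → k * d + k * d ≡ (+ 2 * k) * d
  double = solve-∀
  halves : ∀ b → ∑ (λ a → sign ((b ∧ false) xor ⟨ s , a ⟩)) (allVecs n) + ∑ (λ a → sign ((b ∧ true) xor ⟨ s , a ⟩)) (allVecs n)
                 ≡ + (2 ^ suc n) * 𝟙 (does ((b ∷ s) ≟ 𝟎))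
  halves false = begin
    S + S                                                      ≡⟨ cong₂ _+_ (∑-character s) (∑-character s) ⟩
    + (2 ^ n) * 𝟙 (does (s ≟ 𝟎)) + + (2 ^ n) * 𝟙 (does (s ≟ 𝟎)) ≡⟨ double (+ (2 ^ n)) (𝟙 (does (s ≟ 𝟎))) ⟩
    (+ 2 * + (2 ^ n)) * 𝟙 (does (s ≟ 𝟎))                       ≡⟨ cong (_* 𝟙 (does (s ≟ 𝟎))) (ℤ.pos-* 2 (2 ^ n)) ⟨
    + (2 ^ suc n) * 𝟙 (does (s ≟ 𝟎))                           ∎
  halves true = begin
    S + ∑ (λ a → sign (not ⟨ s , a ⟩)) (allVecs n)
      ≡⟨ cong (_+_ S) (trans (∑-cong (allVecs n) (λ a → sign-not ⟨ s , a ⟩)) (∑-neg (λ a → sign ⟨ s , a ⟩) (allVecs n))) ⟩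
    S - S                                            ≡⟨ ℤ.+-inverseʳ S ⟩
    + 0                                              ≡⟨ ℤ.*-zeroʳ (+ (2 ^ suc n)) ⟨
    + (2 ^ suc n) * + 0                              ∎

∑-nonzeroVecs : (f : 𝔽₂^ m → ℤ) → ∑ f (nonzeroVecs m) ≡ ∑ f (allVecs m) - f 𝟎
∑-nonzeroVecs {m} f = begin
  ∑ f (nonzeroVecs m)                                                ≡⟨ ∑-filter (λ b → isZero b Bool.≟ false) f (allVecs m) ⟩
  ∑ (λ b → if does (isZero b Bool.≟ false) then f b else + 0) (allVecs m) ≡⟨ ∑-cong (allVecs m) drop-𝟎 ⟩
  ∑ (λ b → f b - (if does (b ≟ 𝟎) then f b else + 0)) (allVecs m)   ≡⟨ ∑-- f _ (allVecs m) ⟩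
  ∑ f (allVecs m) - ∑ (λ b → if does (b ≟ 𝟎) then f b else + 0) (allVecs m)
    ≡⟨ cong (_-_ (∑ f (allVecs m))) (∑-δ _≟_ f (allVecs-unique m) (∈-allVecs 𝟎)) ⟩
  ∑ f (allVecs m) - f 𝟎                                              ∎
  where
  open ≡-Reasoning
  drop-𝟎 : ∀ b → (if does (isZero b Bool.≟ false) then f b else + 0) ≡ f b - (if does (b ≟ 𝟎) then f b else + 0)
  drop-𝟎 b rewrite isZero≡does-≟𝟎 b with does (b ≟ 𝟎)
  ... | true  = sym (ℤ.+-inverseʳ (f b))
  ... | false = sym (ℤ.+-identityʳ (f b))

∑-nonzero-character : (d : 𝔽₂^ m) →
  ∑ (λ b → sign ⟨ b , d ⟩) (nonzeroVecs m) ≡ + (2 ^ m) * 𝟙 (does (d ≟ 𝟎)) - + 1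
∑-nonzero-character {m} d = begin
  ∑ (λ b → sign ⟨ b , d ⟩) (nonzeroVecs m)                   ≡⟨ ∑-nonzeroVecs (λ b → sign ⟨ b , d ⟩) ⟩
  ∑ (λ b → sign ⟨ b , d ⟩) (allVecs m) - sign ⟨ 𝟎 , d ⟩      ≡⟨ cong₂ _-_ (∑-cong (allVecs m) λ b → cong sign (⟨⟩-comm b d))
                                                                             (cong sign (⟨⟩-zeroˡ d)) ⟩
  ∑ (λ b → sign ⟨ d , b ⟩) (allVecs m) - + 1                 ≡⟨ cong (_- + 1) (∑-character d) ⟩
  + (2 ^ m) * 𝟙 (does (d ≟ 𝟎)) - + 1                         ∎
  where open ≡-Reasoning

∑-twisted-character : (c : Bool) (t : 𝔽₂^ n) →
  ∑ (λ a → sign (c xor ⟨ t , a ⟩)) (allVecs n) ≡ sign c * (+ (2 ^ n) * 𝟙 (does (t ≟ 𝟎)))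
∑-twisted-character {n} c t = begin
  ∑ (λ a → sign (c xor ⟨ t , a ⟩)) (allVecs n)   ≡⟨ ∑-cong (allVecs n) (λ a → sign-xor c ⟨ t , a ⟩) ⟩
  ∑ (λ a → sign c * sign ⟨ t , a ⟩) (allVecs n)  ≡⟨ ∑-*ˡ (sign c) _ (allVecs n) ⟩
  sign c * ∑ (λ a → sign ⟨ t , a ⟩) (allVecs n)  ≡⟨ cong (sign c *_) (∑-character t) ⟩
  sign c * (+ (2 ^ n) * 𝟙 (does (t ≟ 𝟎)))         ∎
  where open ≡-Reasoning

does-⊕≟𝟎 : (u w : 𝔽₂^ n) → does ((u ⊕ w) ≟ 𝟎) ≡ does (w ≟ u)
does-⊕≟𝟎 u w with (u ⊕ w) ≟ 𝟎 | w ≟ u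
... | yes _   | yes _    = refl
... | no  _   | no  _    = refl
... | yes u⊕w≡𝟎 | no w≢u = contradiction (sym (⊕≡𝟎⇒≡ u⊕w≡𝟎)) w≢u
... | no u⊕w≢𝟎 | yes refl = contradiction (⊕-self w) u⊕w≢𝟎

sign-∏₄ : ∀ p q r t → sign p * (sign q * (sign r * sign t)) ≡ sign (p xor q xor r xor t)
sign-∏₄ p q r t = sym (begin
  sign (p xor q xor r xor t)                    ≡⟨ sign-xor p _ ⟩
  sign p * sign (q xor r xor t)                 ≡⟨ cong (sign p *_) (sign-xor q _) ⟩
  sign p * (sign q * sign (r xor t))            ≡⟨ cong (λ u → sign p * (sign q * u)) (sign-xor r t) ⟩
  sign p * (sign q * (sign r * sign t))         ∎)
  where open ≡-Reasoning

xor-interchange₄ : ∀ p₁ q₁ p₂ q₂ p₃ q₃ p₄ q₄ →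
  (p₁ xor q₁) xor (p₂ xor q₂) xor (p₃ xor q₃) xor (p₄ xor q₄)
    ≡ (p₁ xor p₂ xor p₃ xor p₄) xor (q₁ xor q₂ xor q₃ xor q₄)
xor-interchange₄ p₁ q₁ p₂ q₂ p₃ q₃ p₄ q₄ = begin
  (p₁ xor q₁) xor (p₂ xor q₂) xor (p₃ xor q₃) xor (p₄ xor q₄)
    ≡⟨ cong (λ u → (p₁ xor q₁) xor (p₂ xor q₂) xor u) (Xor.interchange p₃ q₃ p₄ q₄) ⟩
  (p₁ xor q₁) xor (p₂ xor q₂) xor ((p₃ xor p₄) xor (q₃ xor q₄))
    ≡⟨ cong ((p₁ xor q₁) xor_) (Xor.interchange p₂ q₂ (p₃ xor p₄) (q₃ xor q₄)) ⟩
  (p₁ xor q₁) xor ((p₂ xor p₃ xor p₄) xor (q₂ xor q₃ xor q₄))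
    ≡⟨ Xor.interchange p₁ q₁ (p₂ xor p₃ xor p₄) (q₂ xor q₃ xor q₄) ⟩
  (p₁ xor p₂ xor p₃ xor p₄) xor (q₁ xor q₂ xor q₃ xor q₄) ∎
  where open ≡-Reasoning

xor-homo₄ : (h : 𝔽₂^ n → Bool) → (∀ x y → h (x ⊕ y) ≡ h x xor h y) →
            (x y z w : 𝔽₂^ n) → h x xor h y xor h z xor h w ≡ h (x ⊕ (y ⊕ (z ⊕ w)))
xor-homo₄ h homo x y z w = sym (begin
  h (x ⊕ (y ⊕ (z ⊕ w)))          ≡⟨ homo x _ ⟩
  h x xor h (y ⊕ (z ⊕ w))        ≡⟨ cong (h x xor_) (homo y _) ⟩
  h x xor h y xor h (z ⊕ w)      ≡⟨ cong (λ u → h x xor h y xor u) (homo z w) ⟩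
  h x xor h y xor h z xor h w    ∎)
  where open ≡-Reasoning

walsh-fourth-moment : (g : 𝔽₂^ n → Bool) →
  ∑ (λ a → walsh g a ^4) (allVecs n)
    ≡ ∑³ (λ x y z → + (2 ^ n) * sign (g x xor g y xor g z xor g (x ⊕ (y ⊕ z)))) (allVecs n)
walsh-fourth-moment {n} g = begin
  ∑ (λ a → walsh g a ^4) L
    ≡⟨ ∑-cong L (λ a → trans (∑-^4 (χ a) L) (∑³-cong L λ x y z → ∑-cong L λ w → χ-product a x y z w)) ⟩
  ∑ (λ a → ∑³ (λ x y z → ∑ (λ w → h a x y z w) L) L) L
    ≡⟨ ∑-∑³-swap (λ a x y z → ∑ (λ w → h a x y z w) L) L L ⟩
  ∑³ (λ x y z → ∑ (λ a → ∑ (λ w → h a x y z w) L) L) L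
    ≡⟨ ∑³-cong L (λ x y z → ∑-swap (λ a w → h a x y z w) L L) ⟩
  ∑³ (λ x y z → ∑ (λ w → ∑ (λ a → h a x y z w) L) L) L
    ≡⟨ ∑³-cong L (λ x y z → ∑-cong L λ w →
         trans (∑-twisted-character (G x y z w) (x ⊕ (y ⊕ (z ⊕ w)))) (only-w≡x⊕y⊕z x y z w)) ⟩
  ∑³ (λ x y z → ∑ (λ w → if does (w ≟ (x ⊕ (y ⊕ z))) then K * sign (G x y z w) else + 0) L) L
    ≡⟨ ∑³-cong L (λ x y z → ∑-δ _≟_ (λ w → K * sign (G x y z w)) (allVecs-unique n) (∈-allVecs _)) ⟩
  ∑³ (λ x y z → K * sign (G x y z (x ⊕ (y ⊕ z)))) L ∎
  where
  open ≡-Reasoning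
  L : List (𝔽₂^ n)
  L = allVecs n
  K : ℤ
  K = + (2 ^ n)
  χ : 𝔽₂^ n → 𝔽₂^ n → ℤ
  χ a x = sign (g x xor ⟨ x , a ⟩)
  G : (x y z w : 𝔽₂^ n) → Bool
  G x y z w = g x xor g y xor g z xor g w
  h : (a x y z w : 𝔽₂^ n) → ℤ
  h a x y z w = sign (G x y z w xor ⟨ x ⊕ (y ⊕ (z ⊕ w)) , a ⟩)
  χ-product : ∀ a x y z w → χ a x * (χ a y * (χ a z * χ a w)) ≡ h a x y z w
  χ-product a x y z w = trans (sign-∏₄ (g x xor ⟨ x , a ⟩) (g y xor ⟨ y , a ⟩) (g z xor ⟨ z , a ⟩) (g w xor ⟨ w , a ⟩))
    (cong sign (trans (xor-interchange₄ (g x) ⟨ x , a ⟩ (g y) ⟨ y , a ⟩ (g z) ⟨ z , a ⟩ (g w) ⟨ w , a ⟩)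
                      (cong (G x y z w xor_) (xor-homo₄ ⟨_, a ⟩ (λ u v → ⟨⟩-⊕ˡ u v a) x y z w))))
  reassoc : (x y z w : 𝔽₂^ n) → x ⊕ (y ⊕ (z ⊕ w)) ≡ (x ⊕ (y ⊕ z)) ⊕ w
  reassoc x y z w = trans (cong (x ⊕_) (sym (𝔽.assoc y z w))) (sym (𝔽.assoc x (y ⊕ z) w))
  only-w≡x⊕y⊕z : ∀ x y z w → sign (G x y z w) * (K * 𝟙 (does ((x ⊕ (y ⊕ (z ⊕ w))) ≟ 𝟎)))
                               ≡ (if does (w ≟ (x ⊕ (y ⊕ z))) then K * sign (G x y z w) else + 0)
  only-w≡x⊕y⊕z x y z w = begin
    sign (G x y z w) * (K * 𝟙 (does ((x ⊕ (y ⊕ (z ⊕ w))) ≟ 𝟎)))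
      ≡⟨ cong (λ t → sign (G x y z w) * (K * 𝟙 (does (t ≟ 𝟎)))) (reassoc x y z w) ⟩
    sign (G x y z w) * (K * 𝟙 (does (((x ⊕ (y ⊕ z)) ⊕ w) ≟ 𝟎)))
      ≡⟨ cong (λ b → sign (G x y z w) * (K * 𝟙 b)) (does-⊕≟𝟎 (x ⊕ (y ⊕ z)) w) ⟩
    sign (G x y z w) * (K * 𝟙 (does (w ≟ (x ⊕ (y ⊕ z)))))
      ≡⟨ swap-factors (sign (G x y z w)) K (𝟙 (does (w ≟ (x ⊕ (y ⊕ z))))) ⟩
    K * sign (G x y z w) * 𝟙 (does (w ≟ (x ⊕ (y ⊕ z))))
      ≡⟨ *-𝟙 (K * sign (G x y z w)) (does (w ≟ (x ⊕ (y ⊕ z)))) ⟩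
    (if does (w ≟ (x ⊕ (y ⊕ z))) then K * sign (G x y z w) else + 0) ∎
    where
    swap-factors : ∀ s k d → s * (k * d) ≡ k * s * d
    swap-factors = solve-∀

flatSum : (𝔽₂^ n → 𝔽₂^ m) → (x y z : 𝔽₂^ n) → 𝔽₂^ m
flatSum F x y z = F x ⊕ (F y ⊕ (F z ⊕ F (x ⊕ (y ⊕ z))))

ω-via-flatSums : (F : 𝔽₂^ n → 𝔽₂^ m) →
  ω F ≡ ∑³ (λ x y z → + (2 ^ n) * (+ (2 ^ m) * 𝟙 (does (flatSum F x y z ≟ 𝟎)) - + 1)) (allVecs n)
ω-via-flatSums {n} {m} F = begin
  ∑ (λ b → ∑ (λ a → walsh (component F b) a ^4) L) B
    ≡⟨ ∑-cong B (λ b → trans (walsh-fourth-moment (component F b)) (∑³-cong L λ x y z →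
         cong (λ t → K * sign t) (xor-homo₄ ⟨ b ,_⟩ (⟨⟩-⊕ʳ b) (F x) (F y) (F z) _))) ⟩
  ∑ (λ b → ∑³ (λ x y z → K * sign ⟨ b , flatSum F x y z ⟩) L) B
    ≡⟨ ∑-∑³-swap (λ b x y z → K * sign ⟨ b , flatSum F x y z ⟩) B L ⟩
  ∑³ (λ x y z → ∑ (λ b → K * sign ⟨ b , flatSum F x y z ⟩) B) L
    ≡⟨ ∑³-cong L (λ x y z → trans (∑-*ˡ K (λ b → sign ⟨ b , flatSum F x y z ⟩) B)
                                  (cong (K *_) (∑-nonzero-character (flatSum F x y z)))) ⟩
  ∑³ (λ x y z → K * (+ (2 ^ m) * 𝟙 (does (flatSum F x y z ≟ 𝟎)) - + 1)) L ∎
  where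
  open ≡-Reasoning
  L : List (𝔽₂^ n)
  L = allVecs n
  B : List (𝔽₂^ m)
  B = nonzeroVecs m
  K : ℤ
  K = + (2 ^ n)

nonvanishingTriples : (𝔽₂^ n → 𝔽₂^ m) → ℤ
nonvanishingTriples {n} F = ∑³ (λ x y z → 𝟙 (not (does (flatSum F x y z ≟ 𝟎)))) (allVecs n)

ω-via-nonvanishingTriples : (F : 𝔽₂^ n → 𝔽₂^ m) →
  let K = + (2 ^ n); M = + (2 ^ m) in
  ω F ≡ K * (K * (K * (K * (M - + 1)))) - K * M * nonvanishingTriples F
ω-via-nonvanishingTriples {n} {m} F = begin
  ω F
    ≡⟨ ω-via-flatSums F ⟩
  ∑³ (λ x y z → K * (M * 𝟙 (does (flatSum F x y z ≟ 𝟎)) - + 1)) L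
    ≡⟨ ∑³-cong L (λ x y z → split (does (flatSum F x y z ≟ 𝟎))) ⟩
  ∑³ (λ x y z → K * (M - + 1) - K * M * 𝟙 (not (does (flatSum F x y z ≟ 𝟎)))) L
    ≡⟨ ∑³-affine (K * (M - + 1)) (K * M) _ L ⟩
  + length L * (+ length L * (+ length L * (K * (M - + 1)))) - K * M * nonvanishingTriples F
    ≡⟨ cong (λ k → k * (k * (k * (K * (M - + 1)))) - K * M * nonvanishingTriples F) (cong +_ (length-allVecs n)) ⟩
  K * (K * (K * (K * (M - + 1)))) - K * M * nonvanishingTriples F ∎
  where
  open ≡-Reasoning
  L : List (𝔽₂^ n)
  L = allVecs n
  K M : ℤ
  K = + (2 ^ n)
  M = + (2 ^ m)
  split : ∀ c → K * (M * 𝟙 c - + 1) ≡ K * (M - + 1) - K * M * 𝟙 (not c)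
  split true  = vanishing K M
    where vanishing : ∀ k m → k * (m * + 1 - + 1) ≡ k * (m - + 1) - k * m * + 0
          vanishing = solve-∀
  split false = nonvanishing K M
    where nonvanishing : ∀ k m → k * (m * + 0 - + 1) ≡ k * (m - + 1) - k * m * + 1
          nonvanishing = solve-∀

-- Flats through three points

subset : (𝔽₂^ n → Bool) → Subset n
subset {zero}  p = p []
subset {suc n} p = subset (λ x → p (false ∷ x)) , subset (λ x → p (true ∷ x))

member-subset : (p : 𝔽₂^ n → Bool) (w : 𝔽₂^ n) → member w (subset p) ≡ p w
member-subset p []          = refl
member-subset p (false ∷ w) = member-subset (λ x → p (false ∷ x)) w
member-subset p (true ∷ w)  = member-subset (λ x → p (true ∷ x)) w

member-injective : {S T : Subset n} → (∀ w → member w S ≡ member w T) → S ≡ T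
member-injective {zero}  eq = eq []
member-injective {suc n} eq = cong₂ _,_ (member-injective (λ w → eq (false ∷ w))) (member-injective (λ w → eq (true ∷ w)))

∈ₛ⇔member : (w : 𝔽₂^ n) (S : Subset n) → (w ∈ₛ S) ⇔ (member w S ≡ true)
∈ₛ⇔member []          S       = mk⇔ (λ p → p) (λ p → p)
∈ₛ⇔member (false ∷ w) (S , _) = ∈ₛ⇔member w S
∈ₛ⇔member (true ∷ w)  (_ , S) = ∈ₛ⇔member w S

subset-ext : {S T : Subset n} → (∀ w → (w ∈ₛ S) ⇔ (w ∈ₛ T)) → S ≡ T
subset-ext {S = S} {T} S⇔T = member-injective λ w →
  same-truth (⇔-trans (⇔-sym (∈ₛ⇔member w S)) (⇔-trans (S⇔T w) (∈ₛ⇔member w T)))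
  where
  same-truth : {b c : Bool} → (b ≡ true) ⇔ (c ≡ true) → b ≡ c
  same-truth {false} {false} _ = refl
  same-truth {true}  {true}  _ = refl
  same-truth {false} {true}  b⇔c = Equivalence.from b⇔c refl
  same-truth {true}  {false} b⇔c = sym (Equivalence.to b⇔c refl)

subset-≡-dec : ∀ n → DecidableEquality (Subset n)
subset-≡-dec zero    = Bool._≟_
subset-≡-dec (suc n) = Product.≡-dec (subset-≡-dec n) (subset-≡-dec n)

Distinct : {A : Set} (x y z : A) → Set
Distinct x y z = y ≢ x × z ≢ x × z ≢ y

distinct? : {A : Set} → DecidableEquality A → (x y z : A) → Dec (Distinct x y z)
distinct? _≟_ x y z = ¬? (y ≟ x) ×-dec ¬? (z ≟ x) ×-dec ¬? (z ≟ y)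

points : (x y z : 𝔽₂^ n) → List (𝔽₂^ n)
points x y z = x ∷ y ∷ z ∷ x ⊕ (y ⊕ z) ∷ []

plane-covered : (p q r w : 𝔽₂^ 2) → Distinct p q r → w ∈ points p q r
plane-covered p q r w = All.lookup (All.lookup (All.lookup (All.lookup exhaustive
  (∈-allVecs p)) (∈-allVecs q)) (∈-allVecs r)) (∈-allVecs w)
  where
  plane : List (𝔽₂^ 2)
  plane = allVecs 2
  exhaustive : All (λ p → All (λ q → All (λ r → All (λ w →
                 Distinct p q r → w ∈ points p q r) plane) plane) plane) plane
  exhaustive = toWitness {a? = all? (λ p → all? (λ q → all? (λ r → all? (λ w →
                                 distinct? _≟_ p q r →-dec w ∈? points p q r) plane) plane) plane) plane} _

does-true⇔ : {A : Set} (a? : Dec A) → (does a? ≡ true) ⇔ A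
does-true⇔ (yes a) = mk⇔ (λ _ → a) (λ _ → refl)
does-true⇔ (no ¬a) = mk⇔ (λ ()) (λ a → contradiction a ¬a)

flatThrough : (x y z : 𝔽₂^ n) → Subset n
flatThrough x y z = subset (λ w → does (w ∈? points x y z))

∈ₛ-flatThrough⇔ : (x y z w : 𝔽₂^ n) → (w ∈ₛ flatThrough x y z) ⇔ (w ∈ points x y z)
∈ₛ-flatThrough⇔ x y z w = begin
  w ∈ₛ flatThrough x y z                   ≈⟨ ∈ₛ⇔member w _ ⟩
  member w (flatThrough x y z) ≡ true      ≡⟨ cong (_≡ true) (member-subset _ w) ⟩
  does (w ∈? points x y z) ≡ true          ≈⟨ does-true⇔ (w ∈? points x y z) ⟩
  w ∈ points x y z                         ∎
  where open import Relation.Binary.Reasoning.Setoid (⇔-setoid 0ℓ)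

module _ {x y z : 𝔽₂^ n} (distinct : Distinct x y z) where

  private
    s : 𝔽₂^ n
    s = x ⊕ (y ⊕ z)
    y≢x : y ≢ x
    y≢x = proj₁ distinct
    z≢x : z ≢ x
    z≢x = proj₁ (proj₂ distinct)
    z≢y : z ≢ y
    z≢y = proj₂ (proj₂ distinct)

  s≢x : s ≢ x
  s≢x s≡x = z≢y (sym (⊕≡𝟎⇒≡ (𝔽.identityʳ-unique x (y ⊕ z) s≡x)))

  s≢y : s ≢ y
  s≢y s≡y = z≢x (sym (⊕≡𝟎⇒≡ (𝔽.identityʳ-unique y (x ⊕ z) (trans (sym (𝔽.x∙yz≈y∙xz x y z)) s≡y))))

  s≢z : s ≢ z
  s≢z s≡z = y≢x (sym (⊕≡𝟎⇒≡ (𝔽.identityʳ-unique z (x ⊕ y) (trans (sym (𝔽.x∙yz≈z∙xy x y z)) s≡z))))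

  points-unique : Unique (points x y z)
  points-unique = ((y≢x ∘ sym) ∷ (z≢x ∘ sym) ∷ (s≢x ∘ sym) ∷ [])
                ∷ ((z≢y ∘ sym) ∷ (s≢y ∘ sym) ∷ [])
                ∷ ((s≢z ∘ sym) ∷ [])
                ∷ [] ∷ []

  private
    vertex : Bool → Bool → 𝔽₂^ n
    vertex false false = x
    vertex true  false = y
    vertex false true  = z
    vertex true  true  = s

    vertex∈points : ∀ λ₁ λ₂ → vertex λ₁ λ₂ ∈ points x y z
    vertex∈points false false = here refl
    vertex∈points true  false = there (here refl)
    vertex∈points false true  = there (there (here refl))
    vertex∈points true  true  = there (there (there (here refl)))

    points⊆vertices : ∀ {w} → w ∈ points x y z → ∃[ λ₁ ] ∃[ λ₂ ] (w ≡ vertex λ₁ λ₂)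
    points⊆vertices (here refl)                         = false , false , refl
    points⊆vertices (there (here refl))                 = true  , false , refl
    points⊆vertices (there (there (here refl)))         = false , true  , refl
    points⊆vertices (there (there (there (here refl)))) = true  , true  , refl

    corner : Bool → Bool → 𝔽₂^ n
    corner λ₁ λ₂ = x ⊕ ((λ₁ · (x ⊕ y)) ⊕ (λ₂ · (x ⊕ z)))

    [x⊕y]⊕[x⊕z]≡y⊕z : (x ⊕ y) ⊕ (x ⊕ z) ≡ y ⊕ z
    [x⊕y]⊕[x⊕z]≡y⊕z = trans (𝔽.interchange x y x z) (trans (cong (_⊕ (y ⊕ z)) (⊕-self x)) (𝔽.identityˡ (y ⊕ z)))

    corner≡vertex : ∀ λ₁ λ₂ → corner λ₁ λ₂ ≡ vertex λ₁ λ₂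
    corner≡vertex false false rewrite ·-zeroˡ (x ⊕ y) | ·-zeroˡ (x ⊕ z) =
      trans (cong (x ⊕_) (𝔽.identityˡ 𝟎)) (𝔽.identityʳ x)
    corner≡vertex true  false rewrite ·-identityˡ (x ⊕ y) | ·-zeroˡ (x ⊕ z) =
      trans (cong (x ⊕_) (𝔽.identityʳ (x ⊕ y))) (x⊕[x⊕y]≡y x y)
    corner≡vertex false true  rewrite ·-zeroˡ (x ⊕ y) | ·-identityˡ (x ⊕ z) =
      trans (cong (x ⊕_) (𝔽.identityˡ (x ⊕ z))) (x⊕[x⊕y]≡y x z)
    corner≡vertex true  true  rewrite ·-identityˡ (x ⊕ y) | ·-identityˡ (x ⊕ z) =
      cong (x ⊕_) [x⊕y]⊕[x⊕z]≡y⊕z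

    independent : LinIndep₂ (x ⊕ y) (x ⊕ z)
    independent λ₁ λ₂ lin≡𝟎 =
      only-x λ₁ λ₂ (trans (sym (corner≡vertex λ₁ λ₂)) (trans (cong (x ⊕_) lin≡𝟎) (𝔽.identityʳ x)))
      where
      only-x : ∀ λ₁ λ₂ → vertex λ₁ λ₂ ≡ x → (λ₁ ≡ false) × (λ₂ ≡ false)
      only-x false false _   = refl , refl
      only-x true  false y≡x = contradiction y≡x y≢x
      only-x false true  z≡x = contradiction z≡x z≢x
      only-x true  true  s≡x = contradiction s≡x s≢x

  flatThrough-is2Flat : Is2Flat (flatThrough x y z)
  flatThrough-is2Flat = x , x ⊕ y , x ⊕ z , independent , λ w → ⇔-trans (∈ₛ-flatThrough⇔ x y z w) (mk⇔
    (λ w∈ → let λ₁ , λ₂ , w≡ = points⊆vertices w∈ in λ₁ , λ₂ , trans w≡ (sym (corner≡vertex λ₁ λ₂)))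
    (λ { (λ₁ , λ₂ , w≡) → subst (_∈ points x y z) (sym (trans w≡ (corner≡vertex λ₁ λ₂))) (vertex∈points λ₁ λ₂) }))

  sumOver-flatThrough : ∀ {m} (F : 𝔽₂^ n → 𝔽₂^ m) → sumOver (flatThrough x y z) F ≡ flatSum F x y z
  sumOver-flatThrough F = begin
    sumOver (flatThrough x y z) F
      ≡⟨ ∑ᵥ.∑-cong (allVecs n) (λ w → cong (if_then F w else 𝟎) (member-subset _ w)) ⟩
    ∑ᵥ.∑ (λ w → if does (w ∈? points x y z) then F w else 𝟎) (allVecs n)
      ≡⟨ ∑ᵥ.∑-select _≟_ F (points x y z) (allVecs-unique n) points-unique (λ {w} _ → ∈-allVecs w) ⟩
    F x ⊕ (F y ⊕ (F z ⊕ (F s ⊕ 𝟎)))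
      ≡⟨ cong (λ t → F x ⊕ (F y ⊕ (F z ⊕ t))) (𝔽.identityʳ (F s)) ⟩
    flatSum F x y z ∎
    where open ≡-Reasoning

module TwoFlat {n : ℕ} {S : Subset n} (flat : Is2Flat S) where

  private
    a u v : 𝔽₂^ n
    a = proj₁ flat
    u = proj₁ (proj₂ flat)
    v = proj₁ (proj₂ (proj₂ flat))
    independent : LinIndep₂ u v
    independent = proj₁ (proj₂ (proj₂ (proj₂ flat)))
    spanned : ∀ w → (w ∈ₛ S) ⇔ (∃[ λ₁ ] ∃[ λ₂ ] (w ≡ a ⊕ ((λ₁ · u) ⊕ (λ₂ · v))))
    spanned = proj₂ (proj₂ (proj₂ (proj₂ flat)))

  lin : 𝔽₂^ 2 → 𝔽₂^ n
  lin (l₁ ∷ l₂ ∷ []) = (l₁ · u) ⊕ (l₂ · v)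

  pt : 𝔽₂^ 2 → 𝔽₂^ n
  pt l = a ⊕ lin l

  lin-⊕ : ∀ p q → lin p ⊕ lin q ≡ lin (p ⊕ q)
  lin-⊕ (l₁ ∷ l₂ ∷ []) (k₁ ∷ k₂ ∷ []) =
    trans (𝔽.interchange (l₁ · u) (l₂ · v) (k₁ · u) (k₂ · v))
          (cong₂ _⊕_ (·-distribʳ-xor u l₁ k₁) (·-distribʳ-xor v l₂ k₂))

  lin≡𝟎⇒≡𝟎 : ∀ p → lin p ≡ 𝟎 → p ≡ 𝟎
  lin≡𝟎⇒≡𝟎 (l₁ ∷ l₂ ∷ []) lin≡𝟎 =
    let l₁≡false , l₂≡false = independent l₁ l₂ lin≡𝟎 in cong₂ (λ b c → b ∷ c ∷ []) l₁≡false l₂≡false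

  pt-⊕ : ∀ p q → pt p ⊕ pt q ≡ lin (p ⊕ q)
  pt-⊕ p q = begin
    (a ⊕ lin p) ⊕ (a ⊕ lin q)  ≡⟨ 𝔽.interchange a (lin p) a (lin q) ⟩
    (a ⊕ a) ⊕ (lin p ⊕ lin q)  ≡⟨ cong₂ _⊕_ (⊕-self a) (lin-⊕ p q) ⟩
    𝟎 ⊕ lin (p ⊕ q)            ≡⟨ 𝔽.identityˡ _ ⟩
    lin (p ⊕ q)                ∎
    where open ≡-Reasoning

  pt-injective : ∀ {p q} → pt p ≡ pt q → p ≡ q
  pt-injective {p} {q} pt-p≡pt-q = ⊕≡𝟎⇒≡ (lin≡𝟎⇒≡𝟎 (p ⊕ q)
    (trans (sym (pt-⊕ p q)) (trans (cong (_⊕ pt q) pt-p≡pt-q) (⊕-self (pt q)))))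

  pt-⊕₃ : ∀ p q r → pt p ⊕ (pt q ⊕ pt r) ≡ pt (p ⊕ (q ⊕ r))
  pt-⊕₃ p q r = begin
    (a ⊕ lin p) ⊕ (pt q ⊕ pt r)   ≡⟨ cong ((a ⊕ lin p) ⊕_) (pt-⊕ q r) ⟩
    (a ⊕ lin p) ⊕ lin (q ⊕ r)     ≡⟨ 𝔽.assoc a (lin p) _ ⟩
    a ⊕ (lin p ⊕ lin (q ⊕ r))     ≡⟨ cong (a ⊕_) (lin-⊕ p (q ⊕ r)) ⟩
    a ⊕ lin (p ⊕ (q ⊕ r))         ∎
    where open ≡-Reasoning

  ∈ₛ⇔pt : ∀ w → (w ∈ₛ S) ⇔ (∃[ p ] (w ≡ pt p))
  ∈ₛ⇔pt w = mk⇔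
    (λ w∈S → let l₁ , l₂ , w≡ = Equivalence.to (spanned w) w∈S in l₁ ∷ l₂ ∷ [] , w≡)
    (λ { (l₁ ∷ l₂ ∷ [] , w≡) → Equivalence.from (spanned w) (l₁ , l₂ , w≡) })

  pt∈S : ∀ p → pt p ∈ₛ S
  pt∈S p = Equivalence.from (∈ₛ⇔pt (pt p)) (p , refl)

  points-pt : ∀ p q r → points (pt p) (pt q) (pt r) ≡ map pt (points p q r)
  points-pt p q r = cong (λ t → pt p ∷ pt q ∷ pt r ∷ t ∷ []) (pt-⊕₃ p q r)

  determined-by-distinct-points : ∀ {x y z} → x ∈ₛ S → y ∈ₛ S → z ∈ₛ S → Distinct x y z → S ≡ flatThrough x y z
  determined-by-distinct-points x∈S y∈S z∈S (y≢x , z≢x , z≢y)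
    with Equivalence.to (∈ₛ⇔pt _) x∈S | Equivalence.to (∈ₛ⇔pt _) y∈S | Equivalence.to (∈ₛ⇔pt _) z∈S
  ... | p , refl | q , refl | r , refl = subset-ext λ w → ⇔-trans (S⇔points w) (⇔-sym (∈ₛ-flatThrough⇔ _ _ _ w))
    where
    distinct-coordinates : Distinct p q r
    distinct-coordinates = (λ q≡p → y≢x (cong pt q≡p)) , (λ r≡p → z≢x (cong pt r≡p)) , (λ r≡q → z≢y (cong pt r≡q))
    S⇔points : ∀ w → (w ∈ₛ S) ⇔ (w ∈ points (pt p) (pt q) (pt r))
    S⇔points w rewrite points-pt p q r = mk⇔
      (λ w∈S → let t , w≡pt-t = Equivalence.to (∈ₛ⇔pt w) w∈S in
               subst (_∈ map pt (points p q r)) (sym w≡pt-t) (∈.∈-map⁺ pt (plane-covered p q r t distinct-coordinates)))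
      (λ w∈ → let t , _ , w≡pt-t = ∈.∈-map⁻ pt {xs = points p q r} w∈ in Equivalence.from (∈ₛ⇔pt w) (t , w≡pt-t))

  distinct-points : ∃[ x ] ∃[ y ] ∃[ z ] (x ∈ₛ S × y ∈ₛ S × z ∈ₛ S × Distinct x y z)
  distinct-points = pt o , pt e₁ , pt e₂ , pt∈S o , pt∈S e₁ , pt∈S e₂ ,
                    (λ eq → case pt-injective eq of λ ()) , (λ eq → case pt-injective eq of λ ()) , (λ eq → case pt-injective eq of λ ())
    where
    o e₁ e₂ : 𝔽₂^ 2
    o  = false ∷ false ∷ []
    e₁ = true ∷ false ∷ []
    e₂ = false ∷ true ∷ []

2flat⇒flatThrough : {S : Subset n} → Is2Flat S → ∃[ x ] ∃[ y ] ∃[ z ] (Distinct x y z × S ≡ flatThrough x y z)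
2flat⇒flatThrough flat =
  let x , y , z , x∈S , y∈S , z∈S , distinct = TwoFlat.distinct-points flat
  in x , y , z , distinct , TwoFlat.determined-by-distinct-points flat x∈S y∈S z∈S distinct

-- Counting nonvanishing flats

module _ {A : Set} (_≟_ : DecidableEquality A) {ys : List A} (unique : Unique ys) where

  private
    k : ℤ
    k = + length ys

  ∑-𝟙-≢ : ∀ {x} → x ∈ ys → ∑ (λ y → 𝟙 (not (does (y ≟ x)))) ys ≡ k - + 1
  ∑-𝟙-≢ {x} x∈ys = begin
    ∑ (λ y → 𝟙 (not (does (y ≟ x)))) ys          ≡⟨ ∑-cong ys (λ y → 𝟙-not (does (y ≟ x))) ⟩
    ∑ (λ y → + 1 - 𝟙 (does (y ≟ x))) ys          ≡⟨ ∑-- (λ _ → + 1) (λ y → 𝟙 (does (y ≟ x))) ys ⟩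
    ∑ (λ _ → + 1) ys - ∑ (λ y → 𝟙 (does (y ≟ x))) ys
      ≡⟨ cong₂ _-_ (trans (∑-const (+ 1) ys) (ℤ.*-identityʳ k)) (∑-δ _≟_ (λ _ → + 1) unique x∈ys) ⟩
    k - + 1                                        ∎
    where
    open ≡-Reasoning
    𝟙-not : ∀ b → 𝟙 (not b) ≡ + 1 - 𝟙 b
    𝟙-not false = refl
    𝟙-not true  = refl

  ∑-𝟙-≢₂ : ∀ {x y} → x ∈ ys → y ∈ ys → y ≢ x →
           ∑ (λ z → 𝟙 (not (does (z ≟ x)) ∧ not (does (z ≟ y)))) ys ≡ k - + 1 - + 1
  ∑-𝟙-≢₂ {x} {y} x∈ys y∈ys y≢x = begin
    ∑ (λ z → 𝟙 (not (does (z ≟ x)) ∧ not (does (z ≟ y)))) ys        ≡⟨ ∑-cong ys split ⟩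
    ∑ (λ z → 𝟙 (not (does (z ≟ x))) - 𝟙 (does (z ≟ y))) ys
      ≡⟨ ∑-- (λ z → 𝟙 (not (does (z ≟ x)))) (λ z → 𝟙 (does (z ≟ y))) ys ⟩
    ∑ (λ z → 𝟙 (not (does (z ≟ x)))) ys - ∑ (λ z → 𝟙 (does (z ≟ y))) ys
      ≡⟨ cong₂ _-_ (∑-𝟙-≢ x∈ys) (∑-δ _≟_ (λ _ → + 1) unique y∈ys) ⟩
    k - + 1 - + 1                                                      ∎
    where
    open ≡-Reasoning
    split : ∀ z → 𝟙 (not (does (z ≟ x)) ∧ not (does (z ≟ y))) ≡ 𝟙 (not (does (z ≟ x))) - 𝟙 (does (z ≟ y))
    split z with z ≟ x | z ≟ y
    ... | yes refl | yes refl = contradiction refl y≢x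
    ... | yes _    | no  _    = refl
    ... | no  _    | yes _    = refl
    ... | no  _    | no  _    = refl

  ∑-distinct-triples : ∑³ (λ x y z → 𝟙 (does (distinct? _≟_ x y z))) ys ≡ k * ((k - + 1) * (k - + 1 - + 1))
  ∑-distinct-triples = begin
    ∑³ (λ x y z → 𝟙 (does (distinct? _≟_ x y z))) ys
      ≡⟨ ∑-cong∈ ys (λ x x∈ys → ∑-cong∈ ys λ y y∈ys → third x∈ys y∈ys) ⟩
    ∑ (λ x → ∑ (λ y → 𝟙 (not (does (y ≟ x))) * (k - + 1 - + 1)) ys) ys
      ≡⟨ ∑-cong∈ ys (λ x x∈ys → trans (∑-*ʳ (k - + 1 - + 1) (λ y → 𝟙 (not (does (y ≟ x)))) ys)
                                      (cong (_* (k - + 1 - + 1)) (∑-𝟙-≢ x∈ys))) ⟩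
    ∑ (λ _ → (k - + 1) * (k - + 1 - + 1)) ys
      ≡⟨ ∑-const _ ys ⟩
    k * ((k - + 1) * (k - + 1 - + 1)) ∎
    where
    open ≡-Reasoning
    third : ∀ {x y} → x ∈ ys → y ∈ ys →
            ∑ (λ z → 𝟙 (does (distinct? _≟_ x y z))) ys ≡ 𝟙 (not (does (y ≟ x))) * (k - + 1 - + 1)
    third {x} {y} x∈ys y∈ys with y ≟ x
    ... | yes _   = ∑-ε ys
    ... | no  y≢x = trans (∑-𝟙-≢₂ x∈ys y∈ys y≢x) (sym (ℤ.*-identityˡ _))

module _ {n : ℕ} where

  private
    L : List (𝔽₂^ n)
    L = allVecs n

    _≟ₛ_ : DecidableEquality (Subset n)
    _≟ₛ_ = subset-≡-dec n

  ∑-restrict : ∀ {ys} → Unique ys → (f : 𝔽₂^ n → ℤ) → ∑ (λ w → 𝟙 (does (w ∈? ys)) * f w) L ≡ ∑ f ys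
  ∑-restrict {ys} unique f =
    trans (∑-cong L (λ w → 𝟙-* (does (w ∈? ys)) (f w))) (∑-select _≟_ f ys (allVecs-unique n) unique (λ {w} _ → ∈-allVecs w))

  ∑³-restrict : ∀ {ys} → Unique ys → (f : 𝔽₂^ n → 𝔽₂^ n → 𝔽₂^ n → ℤ) →
    ∑³ (λ x y z → 𝟙 (does (x ∈? ys)) * (𝟙 (does (y ∈? ys)) * (𝟙 (does (z ∈? ys)) * f x y z))) L ≡ ∑³ f ys
  ∑³-restrict {ys} unique f = begin
    ∑³ (λ x y z → [ x ] * ([ y ] * ([ z ] * f x y z))) L
      ≡⟨ ∑-cong L (λ x → ∑-cong L λ y → trans (∑-*ˡ [ x ] _ L) (cong ([ x ] *_) (∑-*ˡ [ y ] _ L))) ⟩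
    ∑ (λ x → ∑ (λ y → [ x ] * ([ y ] * ∑ (λ z → [ z ] * f x y z) L)) L) L
      ≡⟨ ∑-cong L (λ x → trans (∑-*ˡ [ x ] _ L) (cong ([ x ] *_) (∑-cong L λ y → cong ([ y ] *_) (∑-restrict unique (f x y))))) ⟩
    ∑ (λ x → [ x ] * ∑ (λ y → [ y ] * ∑ (f x y) ys) L) L
      ≡⟨ ∑-cong L (λ x → cong ([ x ] *_) (∑-restrict unique (λ y → ∑ (f x y) ys))) ⟩
    ∑ (λ x → [ x ] * ∑ (λ y → ∑ (f x y) ys) ys) L
      ≡⟨ ∑-restrict unique (λ x → ∑ (λ y → ∑ (f x y) ys) ys) ⟩
    ∑³ f ys ∎
    where
    open ≡-Reasoning
    [_] : 𝔽₂^ n → ℤ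
    [ w ] = 𝟙 (does (w ∈? ys))

  distinctIn : Subset n → (x y z : 𝔽₂^ n) → ℤ
  distinctIn S x y z = 𝟙 (member x S ∧ (member y S ∧ member z S)) * 𝟙 (does (distinct? _≟_ x y z))

  distinctIn-distinct : ∀ S {x y z} → Distinct x y z → distinctIn S x y z ≡ 𝟙 (member x S ∧ (member y S ∧ member z S))
  distinctIn-distinct S {x} {y} {z} distinct =
    trans (cong (λ b → 𝟙 (member x S ∧ (member y S ∧ member z S)) * 𝟙 b) (dec-true (distinct? _≟_ x y z) distinct))
          (ℤ.*-identityʳ (𝟙 (member x S ∧ (member y S ∧ member z S))))

  distinctIn-degenerate : ∀ S {x y z} → ¬ Distinct x y z → distinctIn S x y z ≡ + 0
  distinctIn-degenerate S {x} {y} {z} degenerate =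
    trans (cong (λ b → 𝟙 (member x S ∧ (member y S ∧ member z S)) * 𝟙 b) (dec-false (distinct? _≟_ x y z) degenerate))
          (ℤ.*-zeroʳ (𝟙 (member x S ∧ (member y S ∧ member z S))))

  2flat-distinct-triples : ∀ {S} → Is2Flat S → ∑³ (distinctIn S) L ≡ + 24
  2flat-distinct-triples flat with 2flat⇒flatThrough flat
  ... | p , q , r , distinct , refl = begin
    ∑³ (distinctIn (flatThrough p q r)) L
      ≡⟨ ∑³-cong L (λ x y z → let d = 𝟙 (does (distinct? _≟_ x y z)) in
           trans (𝟙-∧-* (member x T) (member y T ∧ member z T) d) (cong (𝟙 (member x T) *_) (𝟙-∧-* (member y T) (member z T) d))) ⟩
    ∑³ (λ x y z → 𝟙 (member x T) * (𝟙 (member y T) * (𝟙 (member z T) * 𝟙 (does (distinct? _≟_ x y z))))) L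
      ≡⟨ ∑³-cong L unfold-members ⟩
    ∑³ (λ x y z → 𝟙 (does (x ∈? P)) * (𝟙 (does (y ∈? P)) * (𝟙 (does (z ∈? P)) * 𝟙 (does (distinct? _≟_ x y z))))) L
      ≡⟨ ∑³-restrict (points-unique distinct) _ ⟩
    ∑³ (λ x y z → 𝟙 (does (distinct? _≟_ x y z))) P
      ≡⟨ ∑-distinct-triples _≟_ (points-unique distinct) ⟩
    + 24 ∎
    where
    open ≡-Reasoning
    T : Subset n
    T = flatThrough p q r
    P : List (𝔽₂^ n)
    P = points p q r
    unfold-members : ∀ x y z →
      𝟙 (member x T) * (𝟙 (member y T) * (𝟙 (member z T) * 𝟙 (does (distinct? _≟_ x y z))))
        ≡ 𝟙 (does (x ∈? P)) * (𝟙 (does (y ∈? P)) * (𝟙 (does (z ∈? P)) * 𝟙 (does (distinct? _≟_ x y z))))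
    unfold-members x y z
      rewrite member-subset (λ w → does (w ∈? P)) x
            | member-subset (λ w → does (w ∈? P)) y
            | member-subset (λ w → does (w ∈? P)) z = refl

  member-flatThrough : ∀ {x y z w : 𝔽₂^ n} → w ∈ points x y z → member w (flatThrough x y z) ≡ true
  member-flatThrough {x} {y} {z} {w} w∈ =
    trans (member-subset (λ v → does (v ∈? points x y z)) w) (dec-true (w ∈? points x y z) w∈)

  member³≡does-≟flatThrough : ∀ {S} {x y z : 𝔽₂^ n} → Is2Flat S → Distinct x y z →
    (member x S ∧ (member y S ∧ member z S)) ≡ does (S ≟ₛ flatThrough x y z)
  member³≡does-≟flatThrough {S} {x} {y} {z} flat distinct with S ≟ₛ flatThrough x y z
  ... | yes refl = cong₂ _∧_ (member-flatThrough {x} {y} {z} (here refl))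
                     (cong₂ _∧_ (member-flatThrough {x} {y} {z} (there (here refl)))
                                (member-flatThrough {x} {y} {z} (there (there (here refl)))))
  ... | no S≢T with member x S in x∈S | member y S in y∈S | member z S in z∈S
  ...   | true  | true | true = contradiction (TwoFlat.determined-by-distinct-points flat
                                  (from-member x∈S) (from-member y∈S) (from-member z∈S) distinct) S≢T
    where
    from-member : ∀ {w} → member w S ≡ true → w ∈ₛ S
    from-member {w} = Equivalence.from (∈ₛ⇔member w S)
  ...   | false | _    | _    = refl
  ...   | true  | false | _   = refl
  ...   | true  | true | false = refl

  module _ {m : ℕ} (F : 𝔽₂^ n → 𝔽₂^ m) where

    flatSum-xxz≡𝟎 : ∀ x z → flatSum F x x z ≡ 𝟎
    flatSum-xxz≡𝟎 x z = begin
      F x ⊕ (F x ⊕ (F z ⊕ F (x ⊕ (x ⊕ z))))  ≡⟨ cong (λ t → F x ⊕ (F x ⊕ (F z ⊕ F t))) (x⊕[x⊕y]≡y x z) ⟩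
      F x ⊕ (F x ⊕ (F z ⊕ F z))              ≡⟨ x⊕[x⊕y]≡y (F x) _ ⟩
      F z ⊕ F z                              ≡⟨ ⊕-self (F z) ⟩
      𝟎                                      ∎
      where open ≡-Reasoning

    flatSum-xyx≡𝟎 : ∀ x y → flatSum F x y x ≡ 𝟎
    flatSum-xyx≡𝟎 x y = begin
      F x ⊕ (F y ⊕ (F x ⊕ F (x ⊕ (y ⊕ x))))  ≡⟨ cong (λ t → F x ⊕ (F y ⊕ (F x ⊕ F t))) x⊕[y⊕x]≡y ⟩
      F x ⊕ (F y ⊕ (F x ⊕ F y))              ≡⟨ cong (F x ⊕_) (𝔽.x∙yz≈y∙xz (F y) (F x) (F y)) ⟩
      F x ⊕ (F x ⊕ (F y ⊕ F y))              ≡⟨ x⊕[x⊕y]≡y (F x) _ ⟩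
      F y ⊕ F y                              ≡⟨ ⊕-self (F y) ⟩
      𝟎                                      ∎
      where
      open ≡-Reasoning
      x⊕[y⊕x]≡y : x ⊕ (y ⊕ x) ≡ y
      x⊕[y⊕x]≡y = trans (𝔽.x∙yz≈y∙xz x y x) (trans (cong (y ⊕_) (⊕-self x)) (𝔽.identityʳ y))

    flatSum-xyy≡𝟎 : ∀ x y → flatSum F x y y ≡ 𝟎
    flatSum-xyy≡𝟎 x y = begin
      F x ⊕ (F y ⊕ (F y ⊕ F (x ⊕ (y ⊕ y))))  ≡⟨ cong (λ t → F x ⊕ (F y ⊕ (F y ⊕ F t))) x⊕[y⊕y]≡x ⟩
      F x ⊕ (F y ⊕ (F y ⊕ F x))              ≡⟨ cong (F x ⊕_) (x⊕[x⊕y]≡y (F y) (F x)) ⟩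
      F x ⊕ F x                              ≡⟨ ⊕-self (F x) ⟩
      𝟎                                      ∎
      where
      open ≡-Reasoning
      x⊕[y⊕y]≡x : x ⊕ (y ⊕ y) ≡ x
      x⊕[y⊕y]≡x = trans (cong (x ⊕_) (⊕-self y)) (𝔽.identityʳ x)

    nonvanishing⇒distinct : ∀ {x y z} → flatSum F x y z ≢ 𝟎 → Distinct x y z
    nonvanishing⇒distinct {x} {y} {z} nz =
      (λ { refl → nz (flatSum-xxz≡𝟎 x z) }) , (λ { refl → nz (flatSum-xyx≡𝟎 x y) }) , (λ { refl → nz (flatSum-xyy≡𝟎 x y) })

    flatThrough-nonvanishing : ∀ {x y z} → flatSum F x y z ≢ 𝟎 → IsNonvanishing2Flat F (flatThrough x y z)
    flatThrough-nonvanishing {x} {y} {z} nz = flatThrough-is2Flat distinct , λ sum≡𝟎 →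
      nz (trans (sym (sumOver-flatThrough distinct F)) sum≡𝟎)
      where
      distinct : Distinct x y z
      distinct = nonvanishing⇒distinct nz

    Triple : Set
    Triple = 𝔽₂^ n × 𝔽₂^ n × 𝔽₂^ n

    Nonvanishing : Triple → Set
    Nonvanishing (x , y , z) = flatSum F x y z ≢ 𝟎

    nonvanishing? : (t : Triple) → Dec (Nonvanishing t)
    nonvanishing? (x , y , z) = ¬? (flatSum F x y z ≟ 𝟎)

    flatOf : Triple → Subset n
    flatOf (x , y , z) = flatThrough x y z

    triples : List Triple
    triples = cartesianProduct L (cartesianProduct L L)

    nonvanishingFlats : List (Subset n)
    nonvanishingFlats = deduplicate _≟ₛ_ (map flatOf (filter nonvanishing? triples))

    nonvanishingFlats-unique : Unique nonvanishingFlats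
    nonvanishingFlats-unique = deduplicate-! _≟ₛ_ _

    nonvanishingFlats-sound : ∀ {S} → S ∈ nonvanishingFlats → IsNonvanishing2Flat F S
    nonvanishingFlats-sound S∈ with ∈.∈-map⁻ flatOf (Equivalence.from (∈.deduplicate-∈⇔ _≟ₛ_) S∈)
    ... | (x , y , z) , t∈ , refl = flatThrough-nonvanishing (proj₂ (∈.∈-filter⁻ nonvanishing? {xs = triples} t∈))

    nonvanishingFlats-complete : ∀ {S} → IsNonvanishing2Flat F S → S ∈ nonvanishingFlats
    nonvanishingFlats-complete (flat , nz) with 2flat⇒flatThrough flat
    ... | x , y , z , distinct , refl =
      Equivalence.to (∈.deduplicate-∈⇔ _≟ₛ_) (∈.∈-map⁺ flatOf (∈.∈-filter⁺ nonvanishing?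
        (∈.∈-cartesianProduct⁺ (∈-allVecs x) (∈.∈-cartesianProduct⁺ (∈-allVecs y) (∈-allVecs z)))
        (λ flatSum≡𝟎 → nz (trans (sumOver-flatThrough distinct F) flatSum≡𝟎))))

    -- A nonvanishing triple lies in exactly one flat of the list, the one it spans; other triples lie in none.
    nonvanishing-indicator : ∀ x y z → 𝟙 (not (does (flatSum F x y z ≟ 𝟎))) ≡ ∑ (λ S → distinctIn S x y z) nonvanishingFlats
    nonvanishing-indicator x y z with distinct? _≟_ x y z
    ... | no degenerate = begin
      𝟙 (not (does (flatSum F x y z ≟ 𝟎)))  ≡⟨ cong (𝟙 ∘ not) (dec-true (flatSum F x y z ≟ 𝟎) vanishing) ⟩
      + 0                                   ≡⟨ ∑-ε nonvanishingFlats ⟨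
      ∑ (λ _ → + 0) nonvanishingFlats       ≡⟨ ∑-cong nonvanishingFlats (λ S → distinctIn-degenerate S degenerate) ⟨
      ∑ (λ S → distinctIn S x y z) nonvanishingFlats ∎
      where
      open ≡-Reasoning
      vanishing : flatSum F x y z ≡ 𝟎
      vanishing = decidable-stable (flatSum F x y z ≟ 𝟎) (degenerate ∘ nonvanishing⇒distinct)
    ... | yes distinct = begin
      𝟙 (not (does (flatSum F x y z ≟ 𝟎)))
        ≡⟨ counts-T ⟩
      ∑ (λ S → 𝟙 (does (S ≟ₛ T))) nonvanishingFlats
        ≡⟨ ∑-cong∈ nonvanishingFlats (λ S S∈ →
             cong 𝟙 (member³≡does-≟flatThrough (proj₁ (nonvanishingFlats-sound S∈)) distinct)) ⟨
      ∑ (λ S → 𝟙 (member x S ∧ (member y S ∧ member z S))) nonvanishingFlats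
        ≡⟨ ∑-cong nonvanishingFlats (λ S → distinctIn-distinct S distinct) ⟨
      ∑ (λ S → distinctIn S x y z) nonvanishingFlats ∎
      where
      open ≡-Reasoning
      T : Subset n
      T = flatThrough x y z
      counts-T : 𝟙 (not (does (flatSum F x y z ≟ 𝟎))) ≡ ∑ (λ S → 𝟙 (does (S ≟ₛ T))) nonvanishingFlats
      counts-T with flatSum F x y z ≟ 𝟎
      ... | yes vanishing = sym (∑-δ-∉ _≟ₛ_ (λ _ → + 1) nonvanishingFlats λ T∈ →
                              proj₂ (nonvanishingFlats-sound T∈) (trans (sumOver-flatThrough distinct F) vanishing))
      ... | no nonvanishing = sym (∑-δ _≟ₛ_ (λ _ → + 1) nonvanishingFlats-unique
                                      (nonvanishingFlats-complete (flatThrough-nonvanishing nonvanishing)))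

    nonvanishingTriples≡24·length : nonvanishingTriples F ≡ + length nonvanishingFlats * + 24
    nonvanishingTriples≡24·length = begin
      ∑³ (λ x y z → 𝟙 (not (does (flatSum F x y z ≟ 𝟎)))) L
        ≡⟨ ∑³-cong L nonvanishing-indicator ⟩
      ∑³ (λ x y z → ∑ (λ S → distinctIn S x y z) nonvanishingFlats) L
        ≡⟨ ∑-∑³-swap distinctIn nonvanishingFlats L ⟨
      ∑ (λ S → ∑³ (distinctIn S) L) nonvanishingFlats
        ≡⟨ ∑-cong∈ nonvanishingFlats (λ S S∈ → 2flat-distinct-triples (proj₁ (nonvanishingFlats-sound S∈))) ⟩
      ∑ (λ _ → + 24) nonvanishingFlats
        ≡⟨ ∑-const (+ 24) nonvanishingFlats ⟩
      + length nonvanishingFlats * + 24 ∎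
      where open ≡-Reasoning

pos-3·2^[n+m+3] : ∀ n m → + (3 ℕ.* 2 ^ (n ℕ.+ m ℕ.+ 3)) ≡ + 24 * (+ (2 ^ n) * + (2 ^ m))
pos-3·2^[n+m+3] n m = begin
  + (3 ℕ.* 2 ^ (n ℕ.+ m ℕ.+ 3))              ≡⟨ cong (λ k → + (3 ℕ.* k)) (trans (ℕ.^-distribˡ-+-* 2 (n ℕ.+ m) 3)
                                                   (cong (ℕ._* 8) (ℕ.^-distribˡ-+-* 2 n m))) ⟩
  + (3 ℕ.* (2 ^ n ℕ.* 2 ^ m ℕ.* 8))          ≡⟨ cong +_ (times-24 (2 ^ n) (2 ^ m)) ⟩
  + (24 ℕ.* (2 ^ n ℕ.* 2 ^ m))               ≡⟨ ℤ.pos-* 24 (2 ^ n ℕ.* 2 ^ m) ⟩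
  + 24 * + (2 ^ n ℕ.* 2 ^ m)                 ≡⟨ cong (+ 24 *_) (ℤ.pos-* (2 ^ n) (2 ^ m)) ⟩
  + 24 * (+ (2 ^ n) * + (2 ^ m))             ∎
  where
  open ≡-Reasoning
  times-24 : ∀ a b → 3 ℕ.* (a ℕ.* b ℕ.* 8) ≡ 24 ℕ.* (a ℕ.* b)
  times-24 = ℕ-Solver.solve-∀

pos-2^4n·[2^m∸1] : ∀ n m → let K = + (2 ^ n); M = + (2 ^ m) in
  + (2 ^ (4 ℕ.* n) ℕ.* (2 ^ m ∸ 1)) ≡ K * (K * (K * (K * (M - + 1))))
pos-2^4n·[2^m∸1] n m = begin
  + (2 ^ (4 ℕ.* n) ℕ.* (2 ^ m ∸ 1))                ≡⟨ ℤ.pos-* (2 ^ (4 ℕ.* n)) _ ⟩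
  + (2 ^ (4 ℕ.* n)) * + (2 ^ m ∸ 1)                ≡⟨ cong₂ _*_ (cong +_ 2^4n) (sym (ℤ.⊖-≥ (ℕ.m^n>0 2 m))) ⟩
  + (K ℕ.* (K ℕ.* (K ℕ.* (K ℕ.* 1)))) * (+ (2 ^ m) - + 1)
    ≡⟨ cong (_* (+ (2 ^ m) - + 1)) (pos-*-cong K (pos-*-cong K (pos-*-cong K (ℤ.pos-* K 1)))) ⟩
  + K * (+ K * (+ K * (+ K * + 1))) * (+ (2 ^ m) - + 1) ≡⟨ reassoc (+ K) (+ (2 ^ m)) ⟩
  + K * (+ K * (+ K * (+ K * (+ (2 ^ m) - + 1))))   ∎
  where
  open ≡-Reasoning
  K : ℕ
  K = 2 ^ n
  2^4n : 2 ^ (4 ℕ.* n) ≡ K ℕ.* (K ℕ.* (K ℕ.* (K ℕ.* 1)))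
  2^4n = trans (cong (2 ^_) (ℕ.*-comm 4 n)) (sym (ℕ.^-*-assoc 2 n 4))
  pos-*-cong : ∀ k {l i} → + l ≡ i → + (k ℕ.* l) ≡ + k * i
  pos-*-cong k refl = ℤ.pos-* k _
  reassoc : ∀ k b → k * (k * (k * (k * + 1))) * (b - + 1) ≡ k * (k * (k * (k * (b - + 1))))
  reassoc = solve-∀

nonvanishing2Flats-count : ∀ {n m} (F : 𝔽₂^ n → 𝔽₂^ m) →
  Σ[ N ∈ List (Subset n) ] (Unique N × (∀ S → (S ∈ N) ⇔ IsNonvanishing2Flat F S) ×
    + (3 ℕ.* 2 ^ (n ℕ.+ m ℕ.+ 3)) * + length N ≡ + (2 ^ (4 ℕ.* n) ℕ.* (2 ^ m ∸ 1)) - ω F)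
nonvanishing2Flats-count {n} {m} F =
  nonvanishingFlats F , nonvanishingFlats-unique F ,
  (λ S → mk⇔ (nonvanishingFlats-sound F) (nonvanishingFlats-complete F)) , (begin
    + (3 ℕ.* 2 ^ (n ℕ.+ m ℕ.+ 3)) * ∣N∣              ≡⟨ cong (_* ∣N∣) (pos-3·2^[n+m+3] n m) ⟩
    + 24 * (K * M) * ∣N∣                             ≡⟨ rearrange K M ∣N∣ A ⟩
    A - (A - K * M * (∣N∣ * + 24))                    ≡⟨ cong₂ _-_ (pos-2^4n·[2^m∸1] n m) ω≡ ⟨
    + (2 ^ (4 ℕ.* n) ℕ.* (2 ^ m ∸ 1)) - ω F          ∎)
  where
  open ≡-Reasoning
  K M ∣N∣ A : ℤ
  K = + (2 ^ n)
  M = + (2 ^ m)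
  ∣N∣ = + length (nonvanishingFlats F)
  A = K * (K * (K * (K * (M - + 1))))
  ω≡ : ω F ≡ A - K * M * (∣N∣ * + 24)
  ω≡ = trans (ω-via-nonvanishingTriples F) (cong (λ t → A - K * M * t) (nonvanishingTriples≡24·length F))
  rearrange : ∀ k m l a → + 24 * (k * m) * l ≡ a - (a - k * m * (l * + 24))
  rearrange = solve-∀

theorem3p1 : ((n m : ℕ) (F : 𝔽₂^ n → 𝔽₂^ m) →
                 Σ[ N ∈ List (Subset n) ] (Unique N × (∀ S → (S ∈ N) ⇔ IsNonvanishing2Flat F S) ×
                   ((+ (3 ℕ.* 2 ^ (n ℕ.+ m ℕ.+ 3))) Data.Integer.* (+ length N)
                     ≡ (+ (2 ^ (4 ℕ.* n) ℕ.* (2 ^ m ∸ 1))) - ω F)))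
             × ((n : ℕ) (f : 𝔽₂^ n → Bool) →
                 Σ[ N ∈ List (Subset n) ] (Unique N × (∀ S → (S ∈ N) ⇔ IsNonvanishing2Flat (λ x → f x ∷ []) S) ×
                   ((+ (3 ℕ.* 2 ^ (n ℕ.+ 4))) Data.Integer.* (+ length N)
                     ≡ (+ (2 ^ (4 ℕ.* n))) - ω (λ x → f x ∷ []))))
theorem3p1 = (λ n m → nonvanishing2Flats-count) , λ n f →
  let N , unique , spec , count = nonvanishing2Flats-count (λ x → f x ∷ [])
  in N , unique , spec , subst₂ (λ k l → + (3 ℕ.* 2 ^ k) * + length N ≡ + l - ω (λ x → f x ∷ []))
                                (ℕ.+-assoc n 1 3) (ℕ.*-identityʳ (2 ^ (4 ℕ.* n))) count
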